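{- For all atomic objects $A$, canonical objects $M_0,M$, variables $x_0$ and simple types $\rho_0,\rho$: if $A[M_0/x_0]^o_{\rho_0}=M:\rho$, then $\rho$ is a subexpression of $\rho_0$.
   Context: Syntax (of the canonical system CLLFP). Fix variables $x,y,\dots$, family constants $a$, object constants $c$, and a set of predicate symbols $\mathcal P$. Kinds $K::=\mathrm{Type}\mid \Pi x{:}\sigma.K$; atomic families $\alpha::=a\mid \alpha\,M$; canonical families $\sigma,\tau,\rho::=\alpha\mid \Pi x{:}\sigma.\tau\mid \mathcal L^{\mathcal P}_{N,\sigma}[\rho]$; atomic objects $A::=c\mid x\mid A\,M\mid \mathcal U^{\mathcal P}_{N,\sigma}[A]$; canonical objects $M,N::=A\mid \lambda x{:}\sigma.M\mid \mathcal L^{\mathcal P}_{N,\sigma}[M]$; contexts $\Gamma::=\emptyset\mid \Gamma,x{:}\sigma$. $\Pi$ and $\lambda$ bind $x$; expressions are taken up to renaming of bound variables, with bound variables chosen fresh. Simple types: $\rho::=a\mid \rho_1\to\rho_2\mid \mathcal L^{\mathcal P}_{N,\sigma}[\rho]$. Hereditary substitution is the family of relations, inductively defined by the following rules (all premises use the same $M_0,x_0,\rho_0$ unless written otherwise): $T[M_0/x_0]^m_{\rho_0}=T'$ for $m\in\{K,f,F,O,C\}$, and for atomic objects two forms $A[M_0/x_0]^o_{\rho_0}=A'$ ($A'$ atomic) and $A[M_0/x_0]^o_{\rho_0}=M':\rho$ ($M'$ canonical, $\rho$ simple type). Kinds: $\mathrm{Type}\mapsto\mathrm{Type}$; $\Pi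 x{:}\sigma.K\mapsto \Pi x{:}\sigma'.K'$ if $\sigma\mapsto^F\sigma'$, $K\mapsto^K K'$. Atomic families: $a\mapsto^f a$; $\alpha M\mapsto^f \alpha'M'$ if $\alpha\mapsto^f\alpha'$, $M\mapsto^O M'$. Canonical families: $\alpha\mapsto^F\alpha'$ if $\alpha\mapsto^f\alpha'$; $\Pi x{:}\sigma_1.\sigma_2\mapsto\Pi x{:}\sigma_1'.\sigma_2'$ if $\sigma_i\mapsto^F\sigma_i'$; $\mathcal L^{\mathcal P}_{M_1,\sigma_1}[\sigma_2]\mapsto \mathcal L^{\mathcal P}_{M_1',\sigma_1'}[\sigma_2']$ if $\sigma_1\mapsto^F\sigma_1'$, $M_1\mapsto^O M_1'$, $\sigma_2\mapsto^F\sigma_2'$. Atomic objects: $c\mapsto^o c$; $x_0\mapsto^o M_0:\rho_0$; $x\mapsto^o x$ for $x\neq x_0$; $A_1M_2\mapsto^o M':\rho$ if $A_1\mapsto^o (\lambda x{:}\sigma.M_1'):\rho_2\to\rho$, $M_2\mapsto^O M_2'$ and $M_1'[M_2'/x]^O_{\rho_2}=M'$; $A_1M_2\mapsto^o A_1'M_2'$ if $A_1\mapsto^o A_1'$ (atomic) and $M_2\mapsto^O M_2'$; $\mathcal U^{\mathcal P}_{M,\sigma}[A]\mapsto^o M_1:\rho$ if $\sigma\mapsto^F\sigma'$, $M\mapsto^O M'$ and $A\mapsto^o \mathcal L^{\mathcal P}_{M',\sigma'}[M_1]:\mathcal L^{\mathcal P}_{M',\sigma'}[\rho]$; $\mathcal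 U^{\mathcal P}_{M,\sigma}[A]\mapsto^o \mathcal U^{\mathcal P}_{M',\sigma'}[A']$ if $\sigma\mapsto^F\sigma'$, $M\mapsto^O M'$, $A\mapsto^o A'$ (atomic). Canonical objects: $A\mapsto^O A'$ if $A\mapsto^o A'$ (atomic); $A\mapsto^O M'$ if $A\mapsto^o M':\rho$; $\lambda x{:}\sigma.M\mapsto^O\lambda x{:}\sigma'.M'$ if $\sigma\mapsto^F\sigma'$ and $M\mapsto^O M'$; $\mathcal L^{\mathcal P}_{M_1,\sigma_1}[M_2]\mapsto^O\mathcal L^{\mathcal P}_{M_1',\sigma_1'}[M_2']$ if $\sigma_1\mapsto^F\sigma_1'$, $M_1\mapsto^O M_1'$, $M_2\mapsto^O M_2'$. Contexts: $\emptyset\mapsto^C\emptyset$; $(\Gamma,x{:}\sigma)\mapsto^C(\Gamma',x{:}\sigma')$ if $x\neq x_0$, $x\notin FV(M_0)$, $\Gamma\mapsto^C\Gamma'$, $\sigma\mapsto^F\sigma'$. Here $T\mapsto^m T'$ abbreviates $T[M_0/x_0]^m_{\rho_0}=T'$. -}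

module Defs where

open import Data.Nat using (ℕ; _≟_)
open import Data.List using (List; []; _∷_; _++_; filter)
open import Data.List.Membership.Propositional using (_∈_)
open import Data.Product using (_×_; _,_)
open import Relation.Nullary using (¬_; ¬?)
open import Relation.Binary.PropositionalEquality using (_≡_; _≢_)

Var : Set
Var = ℕ

FConst : Set
FConst = ℕ

OConst : Set
OConst = ℕ

Pred : Set
Pred = ℕ

-- Syntax of CLLFP (named representation).
mutual
  data Kind : Set where
    type : Kind
    ΠK   : Var → CFam → Kind → Kind

  data AFam : Set where
    fcon : FConst → AFam
    fapp : AFam → CObj → AFam

  -- canonical families  σ ::= α | Π x:σ.τ | L^P_{N,σ}[ρ]
  data CFam : Set where
    afam : AFam → CFam
    ΠF   : Var → CFam → CFam → CFam
    LF   : Pred → CObj → CFam → CFam → CFam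

  -- atomic objects  A ::= c | x | A M | U^P_{N,σ}[A]
  data AObj : Set where
    ocon : OConst → AObj
    var  : Var → AObj
    oapp : AObj → CObj → AObj
    UO   : Pred → CObj → CFam → AObj → AObj

  -- canonical objects  M ::= A | λx:σ.M | L^P_{N,σ}[M]
  data CObj : Set where
    atom : AObj → CObj
    lam  : Var → CFam → CObj → CObj
    LO   : Pred → CObj → CFam → CObj → CObj

Ctx : Set
Ctx = List (Var × CFam)

-- simple types  ρ ::= a | ρ₁ → ρ₂ | L^P_{N,σ}[ρ]
data SType : Set where
  base : FConst → SType
  _⇒_  : SType → SType → SType
  LT   : Pred → CObj → CFam → SType → SType

remove : Var → List Var → List Var
remove x = filter (λ y → ¬? (y ≟ x))

mutual
  fvK : Kind → List Var
  fvK type = []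
  fvK (ΠK x σ K) = fvF σ ++ remove x (fvK K)

  fvf : AFam → List Var
  fvf (fcon a) = []
  fvf (fapp α M) = fvf α ++ fvO M

  fvF : CFam → List Var
  fvF (afam α) = fvf α
  fvF (ΠF x σ τ) = fvF σ ++ remove x (fvF τ)
  fvF (LF P N σ ρ) = fvO N ++ fvF σ ++ fvF ρ

  fvo : AObj → List Var
  fvo (ocon c) = []
  fvo (var x) = x ∷ []
  fvo (oapp A M) = fvo A ++ fvO M
  fvo (UO P N σ A) = fvO N ++ fvF σ ++ fvo A

  fvO : CObj → List Var
  fvO (atom A) = fvo A
  fvO (lam x σ M) = fvF σ ++ remove x (fvO M)
  fvO (LO P N σ M) = fvO N ++ fvF σ ++ fvO M

-- Hereditary substitution T[M₀/x₀]^m_{ρ₀} = T', as inductively defined relations.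
mutual
  data SubK (M₀ : CObj) (x₀ : Var) (ρ₀ : SType) : Kind → Kind → Set where
    sK-type : SubK M₀ x₀ ρ₀ type type
    sK-Π    : ∀ {x σ σ' K K'} → SubF M₀ x₀ ρ₀ σ σ' → SubK M₀ x₀ ρ₀ K K' →
              SubK M₀ x₀ ρ₀ (ΠK x σ K) (ΠK x σ' K')

  data Subf (M₀ : CObj) (x₀ : Var) (ρ₀ : SType) : AFam → AFam → Set where
    sf-con : ∀ {a} → Subf M₀ x₀ ρ₀ (fcon a) (fcon a)
    sf-app : ∀ {α α' M M'} → Subf M₀ x₀ ρ₀ α α' → SubO M₀ x₀ ρ₀ M M' →
             Subf M₀ x₀ ρ₀ (fapp α M) (fapp α' M')

  data SubF (M₀ : CObj) (x₀ : Var) (ρ₀ : SType) : CFam → CFam → Set where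
    sF-at : ∀ {α α'} → Subf M₀ x₀ ρ₀ α α' → SubF M₀ x₀ ρ₀ (afam α) (afam α')
    sF-Π  : ∀ {x σ₁ σ₁' σ₂ σ₂'} → SubF M₀ x₀ ρ₀ σ₁ σ₁' → SubF M₀ x₀ ρ₀ σ₂ σ₂' →
            SubF M₀ x₀ ρ₀ (ΠF x σ₁ σ₂) (ΠF x σ₁' σ₂')
    sF-L  : ∀ {P M₁ M₁' σ₁ σ₁' σ₂ σ₂'} → SubF M₀ x₀ ρ₀ σ₁ σ₁' →
            SubO M₀ x₀ ρ₀ M₁ M₁' → SubF M₀ x₀ ρ₀ σ₂ σ₂' →
            SubF M₀ x₀ ρ₀ (LF P M₁ σ₁ σ₂) (LF P M₁' σ₁' σ₂')

  -- A[M₀/x₀]^o_{ρ₀} = A'   (A' atomic)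
  data Subo (M₀ : CObj) (x₀ : Var) (ρ₀ : SType) : AObj → AObj → Set where
    so-con : ∀ {c} → Subo M₀ x₀ ρ₀ (ocon c) (ocon c)
    so-var : ∀ {x} → x ≢ x₀ → Subo M₀ x₀ ρ₀ (var x) (var x)
    so-app : ∀ {A₁ A₁' M₂ M₂'} → Subo M₀ x₀ ρ₀ A₁ A₁' → SubO M₀ x₀ ρ₀ M₂ M₂' →
             Subo M₀ x₀ ρ₀ (oapp A₁ M₂) (oapp A₁' M₂')
    so-U   : ∀ {P M M' σ σ' A A'} → SubF M₀ x₀ ρ₀ σ σ' → SubO M₀ x₀ ρ₀ M M' →
             Subo M₀ x₀ ρ₀ A A' → Subo M₀ x₀ ρ₀ (UO P M σ A) (UO P M' σ' A')

  -- A[M₀/x₀]^o_{ρ₀} = M' : ρ   (M' canonical, ρ simple type)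
  data Subo⇓ (M₀ : CObj) (x₀ : Var) (ρ₀ : SType) : AObj → CObj → SType → Set where
    so⇓-var : Subo⇓ M₀ x₀ ρ₀ (var x₀) M₀ ρ₀
    so⇓-app : ∀ {A₁ x σ M₁' ρ₂ ρ M₂ M₂' M'} →
              Subo⇓ M₀ x₀ ρ₀ A₁ (lam x σ M₁') (ρ₂ ⇒ ρ) →
              SubO M₀ x₀ ρ₀ M₂ M₂' →
              SubO M₂' x ρ₂ M₁' M' →
              Subo⇓ M₀ x₀ ρ₀ (oapp A₁ M₂) M' ρ
    so⇓-U   : ∀ {P M M' σ σ' A M₁ ρ} → SubF M₀ x₀ ρ₀ σ σ' → SubO M₀ x₀ ρ₀ M M' →
              Subo⇓ M₀ x₀ ρ₀ A (LO P M' σ' M₁) (LT P M' σ' ρ) →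
              Subo⇓ M₀ x₀ ρ₀ (UO P M σ A) M₁ ρ

  data SubO (M₀ : CObj) (x₀ : Var) (ρ₀ : SType) : CObj → CObj → Set where
    sO-at  : ∀ {A A'} → Subo M₀ x₀ ρ₀ A A' → SubO M₀ x₀ ρ₀ (atom A) (atom A')
    sO-red : ∀ {A M' ρ} → Subo⇓ M₀ x₀ ρ₀ A M' ρ → SubO M₀ x₀ ρ₀ (atom A) M'
    sO-lam : ∀ {x σ σ' M M'} → SubF M₀ x₀ ρ₀ σ σ' → SubO M₀ x₀ ρ₀ M M' →
             SubO M₀ x₀ ρ₀ (lam x σ M) (lam x σ' M')
    sO-L   : ∀ {P M₁ M₁' σ₁ σ₁' M₂ M₂'} → SubF M₀ x₀ ρ₀ σ₁ σ₁' →
             SubO M₀ x₀ ρ₀ M₁ M₁' → SubO M₀ x₀ ρ₀ M₂ M₂' →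
             SubO M₀ x₀ ρ₀ (LO P M₁ σ₁ M₂) (LO P M₁' σ₁' M₂')

-- contexts (listed with the most recent declaration at the head)
data SubC (M₀ : CObj) (x₀ : Var) (ρ₀ : SType) : Ctx → Ctx → Set where
  sC-nil  : SubC M₀ x₀ ρ₀ [] []
  sC-cons : ∀ {x σ σ' Γ Γ'} → x ≢ x₀ → ¬ (x ∈ fvO M₀) →
            SubC M₀ x₀ ρ₀ Γ Γ' → SubF M₀ x₀ ρ₀ σ σ' →
            SubC M₀ x₀ ρ₀ ((x , σ) ∷ Γ) ((x , σ') ∷ Γ')

data _⊑_ : SType → SType → Set where
  ⊑-refl : ∀ {ρ} → ρ ⊑ ρ
  ⊑-⇒ˡ   : ∀ {ρ ρ₁ ρ₂} → ρ ⊑ ρ₁ → ρ ⊑ (ρ₁ ⇒ ρ₂)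
  ⊑-⇒ʳ   : ∀ {ρ ρ₁ ρ₂} → ρ ⊑ ρ₂ → ρ ⊑ (ρ₁ ⇒ ρ₂)
  ⊑-L    : ∀ {ρ P N σ ρ'} → ρ ⊑ ρ' → ρ ⊑ LT P N σ ρ'

-- Only the head variable x₀ contributes a type, namely ρ₀ itself; every other
-- reducing step (application, unlocking) returns the codomain of a ⇒ or the body
-- of an L of the type produced by its head, so the type only ever shrinks.
module Submission where

open import Defs

⊑-trans : ∀ {ρ₁ ρ₂ ρ₃} → ρ₁ ⊑ ρ₂ → ρ₂ ⊑ ρ₃ → ρ₁ ⊑ ρ₃
⊑-trans p ⊑-refl   = p
⊑-trans p (⊑-⇒ˡ q) = ⊑-⇒ˡ (⊑-trans p q)
⊑-trans p (⊑-⇒ʳ q) = ⊑-⇒ʳ (⊑-trans p q)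
⊑-trans p (⊑-L q)  = ⊑-L (⊑-trans p q)

codomain-⊑ : ∀ {ρ₁ ρ₂ ρ} → (ρ₁ ⇒ ρ₂) ⊑ ρ → ρ₂ ⊑ ρ
codomain-⊑ = ⊑-trans (⊑-⇒ʳ ⊑-refl)

L-body-⊑ : ∀ {P N σ ρ₁ ρ} → LT P N σ ρ₁ ⊑ ρ → ρ₁ ⊑ ρ
L-body-⊑ = ⊑-trans (⊑-L ⊑-refl)

Subo⇓-type-⊑ : ∀ {M₀ x₀ ρ₀ A M ρ} → Subo⇓ M₀ x₀ ρ₀ A M ρ → ρ ⊑ ρ₀
Subo⇓-type-⊑ so⇓-var         = ⊑-refl
Subo⇓-type-⊑ (so⇓-app d _ _) = codomain-⊑ (Subo⇓-type-⊑ d)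
Subo⇓-type-⊑ (so⇓-U _ _ d)   = L-body-⊑ (Subo⇓-type-⊑ d)

mainTheorem2 : ∀ (A : AObj) (M₀ M : CObj) (x₀ : Var) (ρ₀ ρ : SType) →
    Subo⇓ M₀ x₀ ρ₀ A M ρ → ρ ⊑ ρ₀
mainTheorem2 _ _ _ _ _ _ = Subo⇓-type-⊑
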